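{- Let $G=(V,E)$ be a strongly connected finite directed multigraph (parallel edges between the same ordered pair of vertices are allowed and are considered distinct). Then a deadlock-free routing for $G$ exists if and only if there is a vertex $v\in V$ and two edge-disjoint subsets $T_{\mathrm{in}},T_{\mathrm{out}}\subseteq E$ such that $T_{\mathrm{in}}$ forms a spanning directed tree directed into $v$ (every vertex has a directed path to $v$ using only edges of $T_{\mathrm{in}}$) and $T_{\mathrm{out}}$ forms a spanning directed tree directed away from $v$ (every vertex is reachable from $v$ by a directed path using only edges of $T_{\mathrm{out}}$).
   Context: A network is a strongly connected directed multigraph $G=(V,E)$ whose vertices are nodes and whose edges are communication channels. A routing for $G$ is a deterministic assignment, to each ordered pair $(a,b)$ of distinct vertices, of a directed path in $G$ from $a$ to $b$ (depending only on the source and the destination). Given a routing, there is a dependency from edge $e_1$ to edge $e_2$ if some routing path uses $e_2$ immediately after $e_1$. The dependency graph is the directed graph whose vertex set is $E$ and whose edges are these dependencies. A routing is deadlock-free if its dependency graph is acyclic (this is the Dally–Seitz characterization of deadlock freedom). No virtual channels may be added: the routing must use the edges of $G$ as given. No efficiency requirement (e.g. shortest paths) is imposed on the routing. -}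

module Defs where

open import Data.Nat using (ℕ)
open import Data.Fin using (Fin)
open import Data.Fin.Subset using (Subset; _∈_; _∉_)
open import Data.Product using (Σ; ∃; ∃-syntax; _×_; _,_)
open import Relation.Binary.PropositionalEquality using (_≡_; _≢_)
open import Relation.Binary.Construct.Closure.Transitive using (TransClosure)
open import Relation.Nullary using (¬_)

-- A finite directed multigraph: vertices Fin n, edges Fin m (parallel edges
-- are distinct edge indices), each edge e goes from src e to tgt e.
record Multigraph : Set where
  field
    n   : ℕ
    m   : ℕ
    src : Fin m → Fin n
    tgt : Fin m → Fin n

module _ (G : Multigraph) where
  open Multigraph G

  Vertex : Set
  Vertex = Fin n

  Edge : Set
  Edge = Fin m

  data Path : Vertex → Vertex → Set where
    []  : ∀ {a} → Path a a
    _∷_ : ∀ {b} (e : Edge) → Path (tgt e) b → Path (src e) b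

  data UsesOnly (T : Subset m) : ∀ {a b} → Path a b → Set where
    []  : ∀ {a} → UsesOnly T ([] {a})
    _∷_ : ∀ {b} {e : Edge} {p : Path (tgt e) b} →
          e ∈ T → UsesOnly T p → UsesOnly T (e ∷ p)

  data Head (e : Edge) : ∀ {a b} → Path a b → Set where
    head : ∀ {b} (p : Path (tgt e) b) → Head e (e ∷ p)

  data Consecutive (e₁ e₂ : Edge) : ∀ {a b} → Path a b → Set where
    here  : ∀ {b} (p : Path (tgt e₁) b) →
            Head e₂ p → Consecutive e₁ e₂ (e₁ ∷ p)
    there : ∀ {b} (e : Edge) {p : Path (tgt e) b} →
            Consecutive e₁ e₂ p → Consecutive e₁ e₂ (e ∷ p)

  StronglyConnected : Set
  StronglyConnected = (a b : Vertex) → Path a b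

  Routing : Set
  Routing = (a b : Vertex) → a ≢ b → Path a b

  Dependency : Routing → Edge → Edge → Set
  Dependency R e₁ e₂ =
    ∃[ a ] ∃[ b ] Σ (a ≢ b) (λ a≢b → Consecutive e₁ e₂ (R a b a≢b))

  DeadlockFree : Routing → Set
  DeadlockFree R = ∀ e → ¬ TransClosure (Dependency R) e e

  InTree : Vertex → Subset m → Set
  InTree v T =
      (∀ e → e ∈ T → src e ≢ v)
    × (∀ w → w ≢ v → ∃[ e ] (e ∈ T × src e ≡ w ×
                              (∀ e′ → e′ ∈ T → src e′ ≡ w → e′ ≡ e)))
    × (∀ w → Σ (Path w v) (UsesOnly T))

  OutTree : Vertex → Subset m → Set
  OutTree v T =
      (∀ e → e ∈ T → tgt e ≢ v)
    × (∀ w → w ≢ v → ∃[ e ] (e ∈ T × tgt e ≡ w ×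
                              (∀ e′ → e′ ∈ T → tgt e′ ≡ w → e′ ≡ e)))
    × (∀ w → Σ (Path v w) (UsesOnly T))

  EdgeDisjoint : Subset m → Subset m → Set
  EdgeDisjoint S T = ∀ e → e ∈ S → e ∉ T

-- If the trees exist, route a → v inside Tin and then v → b inside Tout. A dependency never
-- leads from an edge of Tout back to an edge of Tin, and inside either tree it moves one level
-- towards, respectively away from, v; so the tree depths give a potential that increases
-- along every dependency.
--
-- Conversely, let R be deadlock-free. Keep a set L of edges that is closed downwards under
-- dependency, and a vertex c that every vertex reaches inside L (initially all edges and an
-- arbitrary vertex). While some edge of L leaves c, follow dependencies inside L from it up to
-- a maximal one f, which exists by acyclicity and lies on an L-walk from c; removing f keeps L
-- down-closed, and c moves to the source of f. When this stops, every route out of c starts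
-- outside L and therefore stays outside L. Shortest-path trees inside L towards c and outside
-- L away from c are then Tin and Tout.

module Submission where

open import Defs
open import Data.Nat using (ℕ; zero; suc; _≤_; _<_; z≤n; s≤s)
open import Data.Nat.Properties using (n<1+n; n≮0; n≤0⇒n≡0)
open import Data.Nat.Induction using (<-wellFounded)
open import Data.Integer using (ℤ; +_; -[1+_]; -<-; -<+; +<+) renaming (_<_ to _<ℤ_)
open import Data.Integer.Properties using (<-trans; <-irrefl)
open import Data.Fin using (Fin; fromℕ<)
open import Data.Fin.Properties using (_≟_; any?)
open import Data.Fin.Subset using (Subset; _∈_; _∉_; _⊆_; _⊂_; _-_; ⁅_⁆; ∁; ⊤)
open import Data.Fin.Subset.Properties
  using (_∈?_; ∈⊤; x∈p⇒p-x⊂p; x∈p∧x≢y⇒x∈p-y; p─q⊆p; x∈∁p⇒x∉p; x∉p⇒x∈∁p)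
open import Data.Fin.Subset.Induction using (⊂-wellFounded)
open import Data.Maybe using (Maybe; just; nothing)
open import Data.Maybe.Properties using (just-injective) renaming (≡-dec to ≡-dec-Maybe)
open import Data.Vec using (tabulate)
open import Data.Vec.Properties using (lookup∘tabulate; []=⇒lookup; lookup⇒[]=)
open import Data.Product using (Σ; ∃-syntax; _×_; _,_; proj₁; proj₂)
open import Data.Sum using (_⊎_; inj₁; inj₂)
open import Data.Empty using (⊥-elim)
open import Function using (_∘_)
open import Function.Bundles using (_⇔_; mk⇔)
open import Induction.WellFounded using (Acc; acc)
open import Level using (Level; 0ℓ)
open import Relation.Binary.Core using (Rel)
open import Relation.Binary.Definitions using (Decidable)
open import Relation.Binary.PropositionalEquality
  using (_≡_; _≢_; refl; sym; trans; cong; subst)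
open import Relation.Binary.Construct.Closure.Transitive using (TransClosure; [_]; _∷_)
open import Relation.Binary.Construct.Closure.ReflexiveTransitive using (Star; ε; _◅_; _◅◅_)
open import Relation.Nullary using (¬_; Dec; yes; no; does)
open import Relation.Nullary.Decidable using (_×-dec_; _⊎-dec_; map′; dec-true)
open import Relation.Nullary.Recomputable using (¬-recompute)
open import Relation.Unary using (Pred) renaming (Decidable to Decidable₁)

private
  variable
    a ℓ : Level
    A : Set a

least-witness : {P : Pred ℕ ℓ} → Decidable₁ P → ∀ {n} → P n →
                ∃[ k ] (P k × ∀ {j} → P j → k ≤ j)
least-witness P? {zero} P0 = 0 , P0 , λ _ → z≤n
least-witness P? {suc n} Pn with P? 0
... | yes P0 = 0 , P0 , λ _ → z≤n
... | no ¬P0 with least-witness (P? ∘ suc) Pn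
...   | k , Pk , least = suc k , Pk , λ { {zero} P0 → ⊥-elim (¬P0 P0) ; {suc j} Pj → s≤s (least Pj) }

module _ {k} {P : Pred (Fin k) ℓ} (P? : Decidable₁ P) where

  select : Subset k
  select = tabulate (does ∘ P?)

  ∈-select⁺ : ∀ {x} → P x → x ∈ select
  ∈-select⁺ {x} Px = lookup⇒[]= x select (trans (lookup∘tabulate (does ∘ P?) x) (dec-true (P? x) Px))

  ∈-select⁻ : ∀ {x} → x ∈ select → P x
  ∈-select⁻ {x} x∈ with P? x | trans (sym (lookup∘tabulate (does ∘ P?) x)) ([]=⇒lookup x∈)
  ... | yes Px | _ = Px
  ... | no _   | ()

map⁺ : {R S : Rel A ℓ} → (∀ {x y} → R x y → S x y) → ∀ {x y} → TransClosure R x y → TransClosure S x y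
map⁺ f [ r ]    = [ f r ]
map⁺ f (r ∷ rs) = f r ∷ map⁺ f rs

star-snoc⁺ : {R : Rel A ℓ} → ∀ {x y z} → Star R x y → R y z → TransClosure R x z
star-snoc⁺ ε        r′ = [ r′ ]
star-snoc⁺ (r ◅ rs) r′ = r ∷ star-snoc⁺ rs r′

increasing⇒acyclic : {R : Rel A ℓ} (φ : A → ℤ) → (∀ {x y} → R x y → φ x <ℤ φ y) →
                     ∀ x → ¬ TransClosure R x x
increasing⇒acyclic {R = R} φ increasing x cycle = <-irrefl refl (along cycle)
  where
    along : ∀ {x y} → TransClosure R x y → φ x <ℤ φ y
    along [ r ]    = increasing r
    along (r ∷ rs) = <-trans (increasing r) (along rs)

module _ {k} {_≺_ : Rel (Fin k) ℓ} (_≺?_ : Decidable _≺_)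
         (acyclic : ∀ x → ¬ TransClosure _≺_ x x) where

  Maximal : Fin k → Set ℓ
  Maximal y = ∀ z → ¬ y ≺ z

  private
    below-after : ∀ {U x z} → (∀ w → w ∉ U → Star _≺_ w x) → x ≺ z → ∀ w → w ∉ U - z → Star _≺_ w z
    below-after {z = z} below x≺z w w∉U-z with w ≟ z
    ... | yes refl = ε
    ... | no w≢z   = below w (λ w∈U → w∉U-z (x∈p∧x≢y⇒x∈p-y w∈U w≢z)) ◅◅ (x≺z ◅ ε)

    -- Everything outside U lies below the current element x, so a successor
    -- of x outside U would close a cycle; hence each step shrinks U.
    climb : ∀ {x} (U : Subset k) → Acc _⊂_ U → (∀ z → z ∉ U → Star _≺_ z x) →
            ∃[ y ] (Star _≺_ x y × Maximal y)
    climb {x} U (acc smaller) below with any? (x ≺?_)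
    ... | no ∄z = x , ε , λ z x≺z → ∄z (z , x≺z)
    ... | yes (z , x≺z) with z ∈? U
    ...   | no z∉U = ⊥-elim (acyclic z (star-snoc⁺ (below z z∉U) x≺z))
    ...   | yes z∈U =
      let (y , z≺*y , y-maximal) = climb (U - z) (smaller (x∈p⇒p-x⊂p z∈U)) (below-after below x≺z)
      in y , x≺z ◅ z≺*y , y-maximal

  maximal-above : ∀ x → ∃[ y ] (Star _≺_ x y × Maximal y)
  maximal-above x = climb ⊤ (⊂-wellFounded ⊤) λ z z∉⊤ → ⊥-elim (z∉⊤ ∈⊤)

PathIn : (G : Multigraph) → Subset (Multigraph.m G) → Vertex G → Vertex G → Set
PathIn G T a b = Σ (Path G a b) (UsesOnly G T)

module _ {G : Multigraph} where
  open Multigraph G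

  infixr 5 _++_
  _++_ : ∀ {a b c} → Path G a b → Path G b c → Path G a c
  []      ++ q = q
  (e ∷ p) ++ q = e ∷ (p ++ q)

  length : ∀ {a b} → Path G a b → ℕ
  length []      = 0
  length (_ ∷ p) = suc (length p)

  usesOnly-++ : ∀ {T a b c} {p : Path G a b} {q : Path G b c} →
                UsesOnly G T p → UsesOnly G T q → UsesOnly G T (p ++ q)
  usesOnly-++ []          q∈T = q∈T
  usesOnly-++ (e∈T ∷ p∈T) q∈T = e∈T ∷ usesOnly-++ p∈T q∈T

  usesOnly-⊤ : ∀ {a b} (p : Path G a b) → UsesOnly G ⊤ p
  usesOnly-⊤ []      = []
  usesOnly-⊤ (_ ∷ p) = ∈⊤ ∷ usesOnly-⊤ p

  prepend : ∀ {T e b c} → e ∈ T → tgt e ≡ b → PathIn G T b c → PathIn G T (src e) c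
  prepend e∈T refl (p , p∈T) = _ ∷ p , e∈T ∷ p∈T

  avoiding : ∀ {T f a} (p : Path G a (src f)) → UsesOnly G T p → PathIn G (T - f) a (src f)
  avoiding [] [] = [] , []
  avoiding {f = f} (e ∷ p) (e∈T ∷ p∈T) with e ≟ f
  ... | yes refl = [] , []
  ... | no e≢f   = prepend (x∈p∧x≢y⇒x∈p-y e∈T e≢f) refl (avoiding p p∈T)

  head-src : ∀ {e a b} {p : Path G a b} → Head G e p → a ≡ src e
  head-src (head _) = refl

  head-∈ : ∀ {T e a b} {p : Path G a b} → Head G e p → UsesOnly G T p → e ∈ T
  head-∈ (head _) (e∈T ∷ _) = e∈T

  head? : ∀ e {a b} (p : Path G a b) → Dec (Head G e p)
  head? e []       = no λ ()
  head? e (e′ ∷ p) with e′ ≟ e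
  ... | yes refl = yes (head p)
  ... | no e′≢e  = no λ { (head _) → e′≢e refl }

  consecutive? : ∀ e₁ e₂ {a b} (p : Path G a b) → Dec (Consecutive G e₁ e₂ p)
  consecutive? e₁ e₂ []      = no λ ()
  consecutive? e₁ e₂ (e ∷ p) with e ≟ e₁ | head? e₂ p | consecutive? e₁ e₂ p
  ... | _        | _     | yes c = yes (there e c)
  ... | yes refl | yes h | no _  = yes (here p h)
  ... | yes refl | no ¬h | no ¬c = no λ { (here _ h) → ¬h h ; (there _ c) → ¬c c }
  ... | no e≢e₁  | _     | no ¬c = no λ { (here _ _) → e≢e₁ refl ; (there _ c) → ¬c c }

  consecutive-adjacent : ∀ {e₁ e₂ a b} {p : Path G a b} → Consecutive G e₁ e₂ p → tgt e₁ ≡ src e₂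
  consecutive-adjacent (here _ h)  = head-src h
  consecutive-adjacent (there _ c) = consecutive-adjacent c

  consecutive-∈ : ∀ {T e₁ e₂ a b} {p : Path G a b} →
                  Consecutive G e₁ e₂ p → UsesOnly G T p → e₁ ∈ T × e₂ ∈ T
  consecutive-∈ (here _ h)  (e∈T ∷ p∈T) = e∈T , head-∈ h p∈T
  consecutive-∈ (there _ c) (_ ∷ p∈T)   = consecutive-∈ c p∈T

  head-++ : ∀ {S T e a b c} {p : Path G a b} {q : Path G b c} →
            Head G e (p ++ q) → UsesOnly G S p → UsesOnly G T q → e ∈ S ⊎ e ∈ T
  head-++ h        []          q∈T = inj₂ (head-∈ h q∈T)
  head-++ (head _) (e∈S ∷ _)   _   = inj₁ e∈S

  consecutive-++ : ∀ {S T e₁ e₂ a b c} {p : Path G a b} {q : Path G b c} →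
                   UsesOnly G S p → UsesOnly G T q → Consecutive G e₁ e₂ (p ++ q) →
                   (e₁ ∈ S × e₂ ∈ S) ⊎ (e₁ ∈ S × e₂ ∈ T) ⊎ (e₁ ∈ T × e₂ ∈ T)
  consecutive-++ []          q∈T c           = inj₂ (inj₂ (consecutive-∈ c q∈T))
  consecutive-++ (e∈S ∷ p∈S) q∈T (here _ h)  with head-++ h p∈S q∈T
  ... | inj₁ e₂∈S = inj₁ (e∈S , e₂∈S)
  ... | inj₂ e₂∈T = inj₂ (inj₁ (e∈S , e₂∈T))
  consecutive-++ (_ ∷ p∈S)   q∈T (there _ c) = consecutive-++ p∈S q∈T c

transpose : Multigraph → Multigraph
transpose G = record { n = n ; m = m ; src = tgt ; tgt = src }
  where open Multigraph G

module _ {G : Multigraph} where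
  open Multigraph G

  private
    reverse-onto : ∀ {T a b c} (p : Path G a b) (q : Path (transpose G) a c) →
                   UsesOnly G T p → UsesOnly (transpose G) T q → PathIn (transpose G) T b c
    reverse-onto []      q []          q∈T = q , q∈T
    reverse-onto (e ∷ p) q (e∈T ∷ p∈T) q∈T = reverse-onto p (e ∷ q) p∈T (e∈T ∷ q∈T)

  reverse : ∀ {T a b} → PathIn G T a b → PathIn (transpose G) T b a
  reverse (p , p∈T) = reverse-onto p [] p∈T []

module _ {G : Multigraph} {v : Vertex G} {T : Subset (Multigraph.m G)} where

  outTree⇒inTree-transpose : OutTree G v T → InTree (transpose G) v T
  outTree⇒inTree-transpose (root , unique , paths) = root , unique , reverse ∘ paths

  inTree-transpose⇒outTree : InTree (transpose G) v T → OutTree G v T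
  inTree-transpose⇒outTree (root , unique , paths) = root , unique , reverse ∘ paths

module InTreeDepth {G : Multigraph} {v : Vertex G} {T : Subset (Multigraph.m G)}
                   (tree : InTree G v T) where
  open Multigraph G

  private
    tree-path : ∀ w → PathIn G T w v
    tree-path = proj₂ (proj₂ tree)

  depth : Vertex G → ℕ
  depth w = length (proj₁ (tree-path w))

  private
    no-edge-from-root : ∀ e → e ∈ T → src e ≢ v
    no-edge-from-root = proj₁ tree

    out-edge-unique : ∀ {e e′} → e ∈ T → e′ ∈ T → src e ≡ src e′ → e ≡ e′
    out-edge-unique {e} {e′} e∈T e′∈T same with proj₁ (proj₂ tree) (src e) (no-edge-from-root e e∈T)
    ... | _ , _ , _ , unique = trans (unique e e∈T refl) (sym (unique e′ e′∈T (sym same)))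

    -- The endpoints are related by equations rather than shared, since matching would
    -- otherwise have to unify src e with src e′ or with v.
    length-unique : ∀ {w w′ x} (p : Path G w x) (q : Path G w′ x) → w ≡ w′ → x ≡ v →
                    UsesOnly G T p → UsesOnly G T q → length p ≡ length q
    length-unique []      []       _    _   _           _           = refl
    length-unique []      (e ∷ _)  w≡w′ x≡v _           (e∈T ∷ _)   =
      ⊥-elim (no-edge-from-root e e∈T (trans (sym w≡w′) x≡v))
    length-unique (e ∷ _) []       w≡w′ x≡v (e∈T ∷ _)   _           =
      ⊥-elim (no-edge-from-root e e∈T (trans w≡w′ x≡v))
    length-unique (e ∷ p) (e′ ∷ q) w≡w′ x≡v (e∈T ∷ p∈T) (e′∈T ∷ q∈T)
      with out-edge-unique e∈T e′∈T w≡w′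
    ... | refl = cong suc (length-unique p q refl x≡v p∈T q∈T)

  depth-step : ∀ {e} → e ∈ T → depth (src e) ≡ suc (depth (tgt e))
  depth-step {e} e∈T =
    length-unique (proj₁ (tree-path (src e))) (e ∷ proj₁ (tree-path (tgt e))) refl refl
                  (proj₂ (tree-path (src e))) (e∈T ∷ proj₂ (tree-path (tgt e)))

module _ {G : Multigraph} {c : Vertex G} {S : Subset (Multigraph.m G)}
         (reach : ∀ w → PathIn G S w c) where
  open Multigraph G

  private
    ReachesWithin : ℕ → Vertex G → Set
    ReachesWithin zero    w = w ≡ c
    ReachesWithin (suc k) w = w ≡ c ⊎ ∃[ e ] (e ∈ S × src e ≡ w × ReachesWithin k (tgt e))

    reachesWithin? : ∀ k w → Dec (ReachesWithin k w)
    reachesWithin? zero    w = w ≟ c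
    reachesWithin? (suc k) w =
      w ≟ c ⊎-dec any? λ e → e ∈? S ×-dec src e ≟ w ×-dec reachesWithin? k (tgt e)

    reachesWithin-length : ∀ {w} {p : Path G w c} → UsesOnly G S p → ReachesWithin (length p) w
    reachesWithin-length []          = refl
    reachesWithin-length (e∈S ∷ p∈S) = inj₂ (_ , e∈S , refl , reachesWithin-length p∈S)

    distance-spec : ∀ w → ∃[ k ] (ReachesWithin k w × ∀ {j} → ReachesWithin j w → k ≤ j)
    distance-spec w = least-witness (λ k → reachesWithin? k w) (reachesWithin-length (proj₂ (reach w)))

    distance : Vertex G → ℕ
    distance w = proj₁ (distance-spec w)

    reachesWithin-distance : ∀ w → ReachesWithin (distance w) w
    reachesWithin-distance w = proj₁ (proj₂ (distance-spec w))

    distance-minimal : ∀ {j w} → ReachesWithin j w → distance w ≤ j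
    distance-minimal = proj₂ (proj₂ (distance-spec _))

    distance-root : distance c ≡ 0
    distance-root = n≤0⇒n≡0 (distance-minimal {0} refl)

    firstEdge : ∀ {k w} → ReachesWithin k w → Maybe (Edge G)
    firstEdge {zero}  _               = nothing
    firstEdge {suc k} (inj₁ _)        = nothing
    firstEdge {suc k} (inj₂ (e , _))  = just e

    firstEdge-just : ∀ {k w e} (r : ReachesWithin k w) → firstEdge r ≡ just e →
                     e ∈ S × src e ≡ w × distance (tgt e) < k
    firstEdge-just {suc k} (inj₂ (e , e∈S , src≡w , r)) refl = e∈S , src≡w , s≤s (distance-minimal r)

    firstEdge-defined : ∀ {k w} (r : ReachesWithin k w) → w ≢ c → ∃[ e ] firstEdge r ≡ just e
    firstEdge-defined {zero}  w≡c            w≢c = ⊥-elim (w≢c w≡c)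
    firstEdge-defined {suc k} (inj₁ w≡c)     w≢c = ⊥-elim (w≢c w≡c)
    firstEdge-defined {suc k} (inj₂ (e , _)) _   = e , refl

    -- The first edge of a shortest S-path from w to c.
    next : Vertex G → Maybe (Edge G)
    next w = firstEdge (reachesWithin-distance w)

    next-just : ∀ {w e} → next w ≡ just e → e ∈ S × src e ≡ w × distance (tgt e) < distance w
    next-just = firstEdge-just (reachesWithin-distance _)

    next-defined : ∀ {w} → w ≢ c → ∃[ e ] next w ≡ just e
    next-defined = firstEdge-defined (reachesWithin-distance _)

    isNext? : Decidable₁ λ e → next (src e) ≡ just e
    isNext? e = ≡-dec-Maybe _≟_ (next (src e)) (just e)

    tree : Subset m
    tree = select isNext?

    tree⊆S : tree ⊆ S
    tree⊆S e∈tree = proj₁ (next-just (∈-select⁻ isNext? e∈tree))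

    no-tree-edge-from-root : ∀ e → e ∈ tree → src e ≢ c
    no-tree-edge-from-root e e∈tree src≡c with next-just (∈-select⁻ isNext? e∈tree)
    ... | _ , _ , closer =
      n≮0 (subst (distance (tgt e) <_) (trans (cong distance src≡c) distance-root) closer)

    tree-out-edge : ∀ w → w ≢ c →
                    ∃[ e ] (e ∈ tree × src e ≡ w × (∀ e′ → e′ ∈ tree → src e′ ≡ w → e′ ≡ e))
    tree-out-edge w w≢c with next-defined w≢c
    ... | e , next≡e with next-just next≡e
    ...   | _ , src≡w , _ =
      e , ∈-select⁺ isNext? (trans (cong next src≡w) next≡e) , src≡w ,
      λ e′ e′∈tree src′≡w →
        just-injective (trans (sym (∈-select⁻ isNext? e′∈tree)) (trans (cong next src′≡w) next≡e))

    tree-path : ∀ w → Acc _<_ (distance w) → PathIn G tree w c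
    tree-path w (acc closer) with w ≟ c
    ... | yes refl = [] , []
    ... | no w≢c with next-defined w≢c
    ...   | e , next≡e with next-just next≡e
    ...     | _ , refl , dist< =
      prepend (∈-select⁺ isNext? next≡e) refl (tree-path (tgt e) (closer dist<))

  inTree-within : ∃[ T ] (T ⊆ S × InTree G c T)
  inTree-within = tree , tree⊆S , no-tree-edge-from-root , tree-out-edge ,
                  λ w → tree-path w (<-wellFounded _)

outTree-within : ∀ {G : Multigraph} {c S} → (∀ w → PathIn G S c w) → ∃[ T ] (T ⊆ S × OutTree G c T)
outTree-within reach with inTree-within (reverse ∘ reach)
... | T , T⊆S , tree = T , T⊆S , inTree-transpose⇒outTree tree

module _ {G : Multigraph} {v : Vertex G} {Tin Tout : Subset (Multigraph.m G)}
         (disjoint : EdgeDisjoint G Tin Tout) (inTree : InTree G v Tin) (outTree : OutTree G v Tout)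
         where
  open Multigraph G

  tree-routing : Routing G
  tree-routing a b _ = proj₁ (proj₂ (proj₂ inTree) a) ++ proj₁ (proj₂ (proj₂ outTree) b)

  private
    module In  = InTreeDepth inTree
    module Out = InTreeDepth (outTree⇒inTree-transpose outTree)

    -- Along a route the in-tree depth of the target of the current edge falls to 0
    -- and then the out-tree depth grows, so this potential increases along every route.
    potential : Edge G → ℤ
    potential e with e ∈? Tout
    ... | yes _ = + Out.depth (tgt e)
    ... | no _  = -[1+ In.depth (tgt e) ]

    potential-in : ∀ {e} → e ∈ Tin → potential e ≡ -[1+ In.depth (tgt e) ]
    potential-in {e} e∈Tin with e ∈? Tout
    ... | yes e∈Tout = ⊥-elim (disjoint e e∈Tin e∈Tout)
    ... | no _       = refl

    potential-out : ∀ {e} → e ∈ Tout → potential e ≡ + Out.depth (tgt e)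
    potential-out {e} e∈Tout with e ∈? Tout
    ... | yes _      = refl
    ... | no e∉Tout  = ⊥-elim (e∉Tout e∈Tout)

    in-in : ∀ {e₁ e₂} → e₁ ∈ Tin → e₂ ∈ Tin → tgt e₁ ≡ src e₂ → potential e₁ <ℤ potential e₂
    in-in e₁∈ e₂∈ adjacent
      rewrite potential-in e₁∈ | potential-in e₂∈ | adjacent | In.depth-step e₂∈ = -<- (n<1+n _)

    in-out : ∀ {e₁ e₂} → e₁ ∈ Tin → e₂ ∈ Tout → potential e₁ <ℤ potential e₂
    in-out e₁∈ e₂∈ rewrite potential-in e₁∈ | potential-out e₂∈ = -<+

    out-out : ∀ {e₁ e₂} → e₁ ∈ Tout → e₂ ∈ Tout → tgt e₁ ≡ src e₂ → potential e₁ <ℤ potential e₂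
    out-out e₁∈ e₂∈ adjacent
      rewrite potential-out e₁∈ | potential-out e₂∈ | Out.depth-step e₂∈ | adjacent = +<+ (n<1+n _)

    dependency-increases : ∀ {e₁ e₂} → Dependency G tree-routing e₁ e₂ → potential e₁ <ℤ potential e₂
    dependency-increases (a , b , _ , c)
      with consecutive-++ (proj₂ (proj₂ (proj₂ inTree) a)) (proj₂ (proj₂ (proj₂ outTree) b)) c
    ... | inj₁ (e₁∈ , e₂∈)        = in-in e₁∈ e₂∈ (consecutive-adjacent c)
    ... | inj₂ (inj₁ (e₁∈ , e₂∈)) = in-out e₁∈ e₂∈
    ... | inj₂ (inj₂ (e₁∈ , e₂∈)) = out-out e₁∈ e₂∈ (consecutive-adjacent c)

  tree-routing-deadlockFree : DeadlockFree G tree-routing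
  tree-routing-deadlockFree = increasing⇒acyclic potential dependency-increases

module _ {G : Multigraph} (R : Routing G) where
  open Multigraph G

  -- The proof of a ≢ b is passed irrelevantly, so the chosen path depends only on a and b
  -- and the dependency relation becomes decidable.
  canonical : Routing G
  canonical a b a≢b = R a b (¬-recompute a≢b)

  canonical-deadlockFree : DeadlockFree G R → DeadlockFree G canonical
  canonical-deadlockFree deadlockFree e cycle =
    deadlockFree e (map⁺ (λ (a , b , _ , c) → a , b , _ , c) cycle)

  canonical-dependency? : Decidable (Dependency G canonical)
  canonical-dependency? e₁ e₂ = any? λ a → any? λ b → dependency-on? a b
    where
      dependency-on? : ∀ a b → Dec (Σ (a ≢ b) λ a≢b → Consecutive G e₁ e₂ (canonical a b a≢b))
      dependency-on? a b with a ≟ b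
      ... | yes a≡b = no λ (a≢b , _) → a≢b a≡b
      ... | no a≢b  = map′ (a≢b ,_) proj₂ (consecutive? e₁ e₂ (canonical a b a≢b))

module _ {G : Multigraph} (strong : StronglyConnected G) (c₀ : Vertex G) {R : Routing G}
         (deadlockFree : DeadlockFree G R) (dependency? : Decidable (Dependency G R)) where
  open Multigraph G

  private
    DownClosed : Subset m → Set
    DownClosed L = ∀ {e₁ e₂} → Dependency G R e₁ e₂ → e₂ ∈ L → e₁ ∈ L

    DependencyInto : Subset m → Rel (Edge G) 0ℓ
    DependencyInto L e g = Dependency G R e g × g ∈ L

    dependency-adjacent : ∀ {e₁ e₂} → Dependency G R e₁ e₂ → tgt e₁ ≡ src e₂
    dependency-adjacent (_ , _ , _ , c) = consecutive-adjacent c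

    chain-path : ∀ {L e f} → Star (DependencyInto L) e f → e ∈ L → f ∈ L × PathIn G L (src e) (src f)
    chain-path ε e∈L = e∈L , [] , []
    chain-path ((dep , g∈L) ◅ chain) e∈L with chain-path chain g∈L
    ... | f∈L , path = f∈L , prepend e∈L (dependency-adjacent dep) path

    reroot : ∀ {L c} → DownClosed L → (∀ a → PathIn G L a c) → ∀ {e} → e ∈ L → src e ≡ c →
             ∃[ f ] (f ∈ L × DownClosed (L - f) × ∀ a → PathIn G (L - f) a (src f))
    reroot {L} closed inward {e} e∈L src≡c
      with maximal-above (λ e g → dependency? e g ×-dec g ∈? L)
                         (λ x cycle → deadlockFree x (map⁺ proj₁ cycle)) e
    ... | f , e≺*f , f-maximal with chain-path e≺*f e∈L
    ...   | f∈L , (q , q∈L) = f , f∈L , closed′ , inward′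
      where
        closed′ : DownClosed (L - f)
        closed′ {e₁} {e₂} dep e₂∈L-f = x∈p∧x≢y⇒x∈p-y (closed dep e₂∈L) e₁≢f
          where
            e₂∈L = p─q⊆p L ⁅ f ⁆ e₂∈L-f
            e₁≢f : e₁ ≢ f
            e₁≢f refl = f-maximal e₂ (dep , e₂∈L)

        inward′ : ∀ a → PathIn G (L - f) a (src f)
        inward′ a with subst (PathIn G L a) (sym src≡c) (inward a)
        ... | p , p∈L = avoiding (p ++ q) (usesOnly-++ p∈L q∈L)

    sink : ∀ {L c} → Acc _⊂_ L → DownClosed L → (∀ a → PathIn G L a c) →
           ∃[ L′ ] ∃[ c′ ] (DownClosed L′ × (∀ a → PathIn G L′ a c′) × (∀ e → e ∈ L′ → src e ≢ c′))
    sink {L} {c} (acc smaller) closed inward with any? (λ e → e ∈? L ×-dec src e ≟ c)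
    ... | no ∄out = L , c , closed , inward , λ e e∈L src≡c → ∄out (e , e∈L , src≡c)
    ... | yes (e , e∈L , src≡c) with reroot closed inward e∈L src≡c
    ...   | f , f∈L , closed′ , inward′ = sink (smaller (x∈p⇒p-x⊂p f∈L)) closed′ inward′

    avoids-downClosed : ∀ {L} → DownClosed L → ∀ {a b} (p : Path G a b) →
                        (∀ {e₁ e₂} → Consecutive G e₁ e₂ p → Dependency G R e₁ e₂) →
                        (∀ {e} → Head G e p → e ∉ L) → UsesOnly G (∁ L) p
    avoids-downClosed         closed []      _    _     = []
    avoids-downClosed {L = L} closed (e ∷ p) deps first =
      x∉p⇒x∈∁p (first (head p)) ∷ avoids-downClosed closed p (λ c → deps (there e c)) second
      where
        second : ∀ {e′} → Head G e′ p → e′ ∉ L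
        second h e′∈L = first (head p) (closed (deps (here p h)) e′∈L)

    paths-from-sink : ∀ {L c} → DownClosed L → (∀ e → e ∈ L → src e ≢ c) → ∀ w → PathIn G (∁ L) c w
    paths-from-sink {L} {c} closed no-out w with c ≟ w
    ... | yes refl = [] , []
    ... | no c≢w   = R c w c≢w , avoids-downClosed closed (R c w c≢w) (λ cons → c , w , c≢w , cons)
                                   (λ h e∈L → no-out _ e∈L (sym (head-src h)))

  deadlockFree⇒trees : ∃[ v ] ∃[ Tin ] ∃[ Tout ]
                         (EdgeDisjoint G Tin Tout × InTree G v Tin × OutTree G v Tout)
  deadlockFree⇒trees
    with sink (⊂-wellFounded ⊤) (λ _ _ → ∈⊤) (λ a → strong a c₀ , usesOnly-⊤ (strong a c₀))
  ... | L , c , closed , inward , no-out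
    with inTree-within inward | outTree-within (paths-from-sink closed no-out)
  ... | Tin , Tin⊆L , inTree | Tout , Tout⊆∁L , outTree =
    c , Tin , Tout , (λ e e∈Tin e∈Tout → x∈∁p⇒x∉p (Tout⊆∁L e∈Tout) (Tin⊆L e∈Tin)) , inTree , outTree

theorem1 : (G : Multigraph) → 1 ≤ Multigraph.n G → StronglyConnected G →
    (Σ (Routing G) (DeadlockFree G)
      ⇔ (∃[ v ] ∃[ Tin ] ∃[ Tout ]
           (EdgeDisjoint G Tin Tout × InTree G v Tin × OutTree G v Tout)))
theorem1 G 1≤n strong = mk⇔
  (λ (R , deadlockFree) → deadlockFree⇒trees strong (fromℕ< 1≤n)
                            (canonical-deadlockFree R deadlockFree) (canonical-dependency? R))
  (λ (_ , _ , _ , disjoint , inTree , outTree) →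
     tree-routing disjoint inTree outTree , tree-routing-deadlockFree disjoint inTree outTree)
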